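{- Let $L$ be a levellised $n$-lattice with $k=\mathrm{dep}_L(n-1)$, let $m$ be a positive integer, and let $A_i\subseteq L\setminus\{0\}$ for $i=n,\ldots,n+m-1$ satisfy: (i) $A_i\cap\mathrm{lev}_k(L)\neq\emptyset$ for all $i$; (ii) each $A_i$ is a lattice-antichain for $L$; (iii) whenever $n\le i<j<n+m$ and $a,b\in(\uparrow_L A_i)\cap(\uparrow_L A_j)$, one has $a\wedge_L b\neq0$. Then: (a) if $L$ is vertically decomposable, then $L_{A_n,\ldots,A_{n+m-1}}$ is vertically decomposable; (b) if $L$ is vertically indecomposable, then $L_{A_n,\ldots,A_{n+m-1}}$ is vertically decomposable if and only if $m=1$ and $\uparrow_L A_n=L\setminus\{0\}$.
   Context: An $n$-poset ($n\ge2$) is a finite poset whose $n$ elements are labelled $0,1,\ldots,n-1$, where $0$ is the least element and $1$ is the greatest element; an $n$-lattice is an $n$-poset that is a lattice, with meet $\wedge_L$. $\uparrow_L A=\{x: a\preceq_L x\text{ for some }a\in A\}$. The depth $\mathrm{dep}_L(a)$ is the integer $p$ such that $p+1$ is the maximum number of elements of a chain in $L$ with least element $a$ and greatest element $1$. $\mathrm{lev}_k(L)=\{a:\mathrm{dep}_L(a)=k\}$. $L$ is levellised if $\mathrm{dep}_L(i)\le\mathrm{dep}_L(j)$ whenever $0<i\le j<n$. A lattice-antichain for $L$ is a non-empty antichain $A\subseteq L\setminus\{0\}$ with $a\wedge_L b\in\{0\}\cup\uparrow_L A$ for all $a,b\in\uparrow_L A$. For $A\subseteq L\setminus\{0\}$,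 $L_A$ is the $(n+1)$-poset on $\{0,\ldots,n\}$ whose order is the reflexive-transitive closure of $\preceq_L$ together with $0\preceq n$ and $n\preceq a$ ($a\in A$); $L_{A_n,\ldots,A_{n+m-1}}=(\cdots(L_{A_n})\cdots)_{A_{n+m-1}}$. An $n$-lattice $L$ is vertically decomposable if there is an element $i\in L\setminus\{0,1\}$ comparable to every element of $L$; otherwise it is vertically indecomposable. -}

module Defs where

open import Level using (0ℓ)
open import Data.Nat using (ℕ; zero; suc; _+_; _≤_; _<_)
open import Data.Fin using (Fin; zero; suc; inject₁; fromℕ; toℕ)
open import Data.Product using (Σ; ∃; _×_; _,_)
open import Data.Sum using (_⊎_)
open import Relation.Nullary using (¬_)
open import Relation.Unary using (Pred)
open import Relation.Binary.Core using (Rel)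
open import Relation.Binary.Definitions using (Minimum; Maximum)
open import Relation.Binary.PropositionalEquality using (_≡_; _≢_)
open import Relation.Binary.Lattice.Structures using (IsLattice)
open import Relation.Binary.Construct.Closure.ReflexiveTransitive using (Star)
open import Algebra.Core using (Op₂)

-- Convention: an N-poset with N = 2 + n elements is an order relation on
-- Fin (2 + n); label 0 is `zero`, label 1 is `suc zero`, label N-1 is fromℕ (suc n).

𝟎 : ∀ {n} → Fin (suc (suc n))
𝟎 = zero

𝟏 : ∀ {n} → Fin (suc (suc n))
𝟏 = suc zero

record IsNLattice {n : ℕ} (_≼_ : Rel (Fin (suc (suc n))) 0ℓ)
                  (_∨_ _∧_ : Op₂ (Fin (suc (suc n)))) : Set where
  field
    isLattice : IsLattice _≡_ _≼_ _∨_ _∧_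
    zero-least : Minimum _≼_ 𝟎
    one-greatest : Maximum _≼_ 𝟏

module _ {n : ℕ} (_≼_ : Rel (Fin (suc (suc n))) 0ℓ) where

  private
    E = Fin (suc (suc n))

  _≺_ : Rel E 0ℓ
  x ≺ y = (x ≼ y) × (x ≢ y)

  -- Chain a b p : a chain a = x₀ ≺ x₁ ≺ … ≺ xₚ = b, i.e. a chain with p+1
  -- elements whose least element is a and greatest element is b.
  data Chain : E → E → ℕ → Set where
    single : ∀ {a} → Chain a a zero
    step   : ∀ {a c b p} → a ≺ c → Chain c b p → Chain a b (suc p)

  -- dep(a) = p : p+1 is the maximum number of elements of a chain from a to 1.
  Dep : E → ℕ → Set
  Dep a p = Chain a 𝟏 p × (∀ q → Chain a 𝟏 q → q ≤ p)

  Lev : ℕ → Pred E 0ℓ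
  Lev k a = Dep a k

  Levellised : Set
  Levellised = ∀ (i j : E) → 0 < toℕ i → toℕ i ≤ toℕ j →
               ∀ p q → Dep i p → Dep j q → p ≤ q

  Up : Pred E 0ℓ → Pred E 0ℓ
  Up A x = ∃ λ a → A a × (a ≼ x)

  AvoidsZero : Pred E 0ℓ → Set
  AvoidsZero A = ∀ a → A a → a ≢ 𝟎

  IsAntichain : Pred E 0ℓ → Set
  IsAntichain A = ∀ a b → A a → A b → a ≼ b → a ≡ b

  IsLatticeAntichain : Op₂ E → Pred E 0ℓ → Set
  IsLatticeAntichain _∧_ A =
    (∃ λ a → A a) × AvoidsZero A × IsAntichain A ×
    (∀ a b → Up A a → Up A b → (a ∧ b ≡ 𝟎) ⊎ Up A (a ∧ b))

  VertDecomp : Set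
  VertDecomp = ∃ λ i → i ≢ 𝟎 × i ≢ 𝟏 × (∀ x → (i ≼ x) ⊎ (x ≼ i))

-- One-point extension L_A: the new element is labelled N = 2+n (fromℕ (2+n));
-- old elements keep their labels (inject₁).
module _ {n : ℕ} (_≼_ : Rel (Fin (suc (suc n))) 0ℓ) (A : Pred (Fin (suc (suc n))) 0ℓ) where

  data ExtGen : Rel (Fin (suc (suc (suc n)))) 0ℓ where
    old  : ∀ {x y} → x ≼ y → ExtGen (inject₁ x) (inject₁ y)
    zn   : ExtGen (inject₁ 𝟎) (fromℕ (suc (suc n)))
    na   : ∀ {a} → A a → ExtGen (fromℕ (suc (suc n))) (inject₁ a)

  Ext : Rel (Fin (suc (suc (suc n)))) 0ℓ
  Ext = Star ExtGen

emb : ∀ {n} m → Fin (suc (suc n)) → Fin (suc (suc (m + n)))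
emb zero x = x
emb (suc m) x = inject₁ (emb m x)

EmbPred : ∀ {n} m → Pred (Fin (suc (suc n))) 0ℓ → Pred (Fin (suc (suc (m + n)))) 0ℓ
EmbPred m A y = ∃ λ x → A x × (emb m x ≡ y)

-- Iterated extension L_{A_n,…,A_{n+m-1}}; A i stands for A_{n+i}.
ExtMany : ∀ {n} m → Rel (Fin (suc (suc n))) 0ℓ → (Fin m → Pred (Fin (suc (suc n))) 0ℓ) →
          Rel (Fin (suc (suc (m + n)))) 0ℓ
ExtMany zero R A = R
ExtMany (suc m) R A = Ext (ExtMany m R (λ i → A (inject₁ i))) (EmbPred m (A (fromℕ m)))

-- (a) Levellisation makes the elements of level k = dep(n-1) minimal among
-- the nonzero elements, so a point c comparable to everything lies above
-- some element of each A_i, hence above every new point; its image is then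
-- comparable to everything in the extension.
-- (b) If the extension splits at an old point, that point already splits L.
-- Below a new point there is only 0 and itself, so distinct new points are
-- incomparable and a splitting new point forces m = 1; finally n is
-- comparable to x ≠ 0 only by lying below it, i.e. x ∈ ↑A_n.
module Submission where

open import Defs
open import Level using (0ℓ)
open import Algebra.Core using (Op₂)
open import Data.Empty using (⊥-elim)
open import Data.Fin using (Fin; zero; suc; fromℕ; inject₁; toℕ; _<_)
open import Data.Fin.Properties
  using (_≟_; toℕ-inject₁; toℕ-fromℕ; toℕ-injective; toℕ<n; ≤fromℕ; fromℕ≢inject₁;
         any?; pigeonhole)
open import Data.Fin.Relation.Unary.Top using (view; ‵fromℕ; ‵inject₁)
open import Data.Maybe as Maybe using (Maybe; just; nothing)
open import Data.Nat as ℕ using (ℕ; zero; suc; _+_; s≤s)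
import Data.Nat.Properties as ℕₚ
open import Data.Product using (∃; _×_; _,_; proj₁; proj₂; map₂)
open import Data.Sum as Sum using (_⊎_; inj₁; inj₂)
open import Data.Unit using (⊤; tt)
open import Function.Base using (_∘_)
open import Function.Bundles using (_⇔_; mk⇔; Equivalence)
open import Relation.Nullary using (¬_; Dec; yes; no)
open import Relation.Nullary.Decidable using (_×-dec_; ¬?; decidable-stable)
open import Relation.Unary using (Pred)
open import Relation.Binary.Core using (Rel)
open import Relation.Binary.Definitions using (Reflexive; Transitive; Minimum; Decidable)
open import Relation.Binary.Structures using (IsPartialOrder; IsDecPartialOrder)
open import Relation.Binary.Lattice.Bundles using (MeetSemilattice)
open import Relation.Binary.Lattice.Structures using (IsLattice)
open import Relation.Binary.Lattice.Properties.MeetSemilattice using (≈-dec⇒isDecPartialOrder)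
open import Relation.Binary.PropositionalEquality
  using (_≡_; _≢_; refl; sym; trans; cong; subst; subst₂)
open import Relation.Binary.Construct.Closure.ReflexiveTransitive using (ε; _◅_; _◅◅_)

ComparableToAll : ∀ {K} → Rel (Fin K) 0ℓ → Fin K → Set
ComparableToAll R c = ∀ x → R c x ⊎ R x c

bounded-maximum : ∀ {P : ℕ → Set} → (∀ q → Dec (P q)) →
                  ∀ t → (∀ {q} → P q → q ℕ.< t) → ∃ P →
                  ∃ λ p → P p × (∀ q → P q → q ℕ.≤ p)
bounded-maximum P? zero    bound (q , Pq) with () ← bound Pq
bounded-maximum {P} P? (suc t) bound witness with P? t
... | yes Pt = t , Pt , λ q Pq → ℕₚ.≤-pred (bound Pq)
... | no ¬Pt = bounded-maximum P? t bound′ witness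
  where
  bound′ : ∀ {q} → P q → q ℕ.< t
  bound′ {q} Pq with ℕₚ.m≤n⇒m<n∨m≡n (ℕₚ.≤-pred (bound Pq))
  ... | inj₁ q<t  = q<t
  ... | inj₂ refl = ⊥-elim (¬Pt Pq)

decode : ∀ {K} → Fin (suc K) → Maybe (Fin K)
decode {zero}  zero    = nothing
decode {suc K} zero    = just zero
decode {suc K} (suc i) = Maybe.map suc (decode i)

decode-inject₁ : ∀ {K} (i : Fin K) → decode (inject₁ i) ≡ just i
decode-inject₁ {suc K} zero    = refl
decode-inject₁ {suc K} (suc i) = cong (Maybe.map suc) (decode-inject₁ i)

decode-fromℕ : ∀ K → decode (fromℕ K) ≡ nothing
decode-fromℕ zero    = refl
decode-fromℕ (suc K) = cong (Maybe.map suc) (decode-fromℕ K)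

toℕ-emb : ∀ {n} m (x : Fin (suc (suc n))) → toℕ (emb m x) ≡ toℕ x
toℕ-emb zero    x = refl
toℕ-emb (suc m) x = trans (toℕ-inject₁ (emb m x)) (toℕ-emb m x)

emb-injective : ∀ {n} m {x y : Fin (suc (suc n))} → emb m x ≡ emb m y → x ≡ y
emb-injective m {x} {y} e =
  toℕ-injective (trans (sym (toℕ-emb m x)) (trans (cong toℕ e) (toℕ-emb m y)))

emb-𝟎 : ∀ {n} m → emb {n} m 𝟎 ≡ 𝟎
emb-𝟎 zero    = refl
emb-𝟎 (suc m) = cong inject₁ (emb-𝟎 m)

emb-𝟏 : ∀ {n} m → emb {n} m 𝟏 ≡ 𝟏
emb-𝟏 zero    = refl
emb-𝟏 (suc m) = cong inject₁ (emb-𝟏 m)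

emb-≢𝟎 : ∀ {n} m {x : Fin (suc (suc n))} → x ≢ 𝟎 → emb m x ≢ 𝟎
emb-≢𝟎 m x≢𝟎 e = x≢𝟎 (emb-injective m (trans e (sym (emb-𝟎 m))))

emb-≢𝟏 : ∀ {n} m {x : Fin (suc (suc n))} → x ≢ 𝟏 → emb m x ≢ 𝟏
emb-≢𝟏 m x≢𝟏 e = x≢𝟏 (emb-injective m (trans e (sym (emb-𝟏 m))))

Ext-inject₁ : ∀ {n} {R : Rel (Fin (suc (suc n))) 0ℓ} {B} {x y} → R x y → Ext R B (inject₁ x) (inject₁ y)
Ext-inject₁ x≤y = old x≤y ◅ ε

module OnePoint {n : ℕ} (R : Rel (Fin (suc (suc n))) 0ℓ) (B : Pred (Fin (suc (suc n))) 0ℓ)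
                (R-refl : Reflexive R) (R-trans : Transitive R) (R-least : Minimum R 𝟎) where

  new : Fin (suc (suc (suc n)))
  new = fromℕ (suc (suc n))

  -- The order of L_B seen through decode, with `nothing` for the new point;
  -- it is transitive, so it contains the closure Ext R B.
  _⊑_ : Rel (Maybe (Fin (suc (suc n)))) 0ℓ
  just x  ⊑ just y  = R x y
  just x  ⊑ nothing = R x 𝟎
  nothing ⊑ just y  = ∃ λ b → B b × R b y
  nothing ⊑ nothing = ⊤

  ⊑-refl : Reflexive _⊑_
  ⊑-refl {just x}  = R-refl
  ⊑-refl {nothing} = tt

  ⊑-trans : Transitive _⊑_
  ⊑-trans {just x}  {just y}  {just z}  p q = R-trans p q
  ⊑-trans {just x}  {just y}  {nothing} p q = R-trans p q
  ⊑-trans {just x}  {nothing} {just z}  p q = R-trans p (R-least z)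
  ⊑-trans {just x}  {nothing} {nothing} p q = p
  ⊑-trans {nothing} {just y}  {just z}  (b , Bb , p) q = b , Bb , R-trans p q
  ⊑-trans {nothing} {just y}  {nothing} p q = tt
  ⊑-trans {nothing} {nothing} {just z}  p q = q
  ⊑-trans {nothing} {nothing} {nothing} p q = tt

  ExtGen⇒⊑ : ∀ {s t} → ExtGen R B s t → decode s ⊑ decode t
  ExtGen⇒⊑ (old {x} {y} x≤y) = subst₂ _⊑_ (sym (decode-inject₁ x)) (sym (decode-inject₁ y)) x≤y
  ExtGen⇒⊑ zn = subst₂ _⊑_ (sym (decode-inject₁ 𝟎)) (sym (decode-fromℕ (suc (suc n)))) R-refl
  ExtGen⇒⊑ (na {a} Ba) =
    subst₂ _⊑_ (sym (decode-fromℕ (suc (suc n)))) (sym (decode-inject₁ a)) (a , Ba , R-refl)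

  Ext⇒⊑ : ∀ {s t} → Ext R B s t → decode s ⊑ decode t
  Ext⇒⊑ {s}     ε                  = ⊑-refl {decode s}
  Ext⇒⊑ {s} {t} (_◅_ {j = j} g gs) = ⊑-trans {decode s} {decode j} {decode t} (ExtGen⇒⊑ g) (Ext⇒⊑ gs)

  Ext-reflect : ∀ {x y} → Ext R B (inject₁ x) (inject₁ y) → R x y
  Ext-reflect {x} {y} p = subst₂ _⊑_ (decode-inject₁ x) (decode-inject₁ y) (Ext⇒⊑ p)

  Ext-new-old : ∀ {y} → Ext R B new (inject₁ y) → ∃ λ b → B b × R b y
  Ext-new-old {y} p = subst₂ _⊑_ (decode-fromℕ (suc (suc n))) (decode-inject₁ y) (Ext⇒⊑ p)

  Ext-old-new : ∀ {x} → Ext R B (inject₁ x) new → R x 𝟎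
  Ext-old-new {x} p = subst₂ _⊑_ (decode-inject₁ x) (decode-fromℕ (suc (suc n))) (Ext⇒⊑ p)

module Iterated {n : ℕ} {_≼_ : Rel (Fin (suc (suc n))) 0ℓ}
                (isPartialOrder : IsPartialOrder _≡_ _≼_) (≼-least : Minimum _≼_ 𝟎) where

  open IsPartialOrder isPartialOrder using (antisym) renaming (refl to ≼-refl; trans to ≼-trans)

  private
    E = Fin (suc (suc n))

  Ext^ : ∀ m → (Fin m → Pred E 0ℓ) → Rel (Fin (suc (suc (m + n)))) 0ℓ
  Ext^ m = ExtMany m _≼_

  IsNew : ∀ {K} → Fin K → Set
  IsNew z = suc (suc n) ℕ.≤ toℕ z

  IsNew? : ∀ {K} (z : Fin K) → Dec (IsNew z)
  IsNew? z = suc (suc n) ℕ.≤? toℕ z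

  IsNew-inject₁ : ∀ {K} {y : Fin K} → IsNew y → IsNew (inject₁ y)
  IsNew-inject₁ {y = y} = subst (suc (suc n) ℕ.≤_) (sym (toℕ-inject₁ y))

  IsNew-inject₁⁻¹ : ∀ {K} {y : Fin K} → IsNew (inject₁ y) → IsNew y
  IsNew-inject₁⁻¹ {y = y} = subst (suc (suc n) ℕ.≤_) (toℕ-inject₁ y)

  IsNew-fromℕ : ∀ m → IsNew (fromℕ (suc (suc (m + n))))
  IsNew-fromℕ m = subst (suc (suc n) ℕ.≤_) (sym (toℕ-fromℕ _)) (s≤s (s≤s (ℕₚ.m≤n+m n m)))

  ¬IsNew-old : (x : E) → ¬ IsNew x
  ¬IsNew-old x = ℕₚ.<⇒≱ (toℕ<n x)

  ¬IsNew-emb : ∀ m (x : E) → ¬ IsNew (emb m x)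
  ¬IsNew-emb m x = ¬IsNew-old x ∘ subst (suc (suc n) ℕ.≤_) (toℕ-emb m x)

  ¬IsNew⇒emb : ∀ m (z : Fin (suc (suc (m + n)))) → ¬ IsNew z → ∃ λ x → emb m x ≡ z
  ¬IsNew⇒emb zero    z _ = z , refl
  ¬IsNew⇒emb (suc m) z z-old with view z
  ... | ‵fromℕ     = ⊥-elim (z-old (IsNew-fromℕ m))
  ... | ‵inject₁ y = map₂ (cong inject₁) (¬IsNew⇒emb m y (z-old ∘ IsNew-inject₁))

  ExtMany-refl : ∀ m A → Reflexive (Ext^ m A)
  ExtMany-refl zero    A = ≼-refl
  ExtMany-refl (suc m) A = ε

  ExtMany-trans : ∀ m A → Transitive (Ext^ m A)
  ExtMany-trans zero    A = ≼-trans
  ExtMany-trans (suc m) A = _◅◅_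

  ExtMany-least : ∀ m A → Minimum (Ext^ m A) 𝟎
  ExtMany-least zero    A   = ≼-least
  ExtMany-least (suc m) A z with view z
  ... | ‵fromℕ     = zn ◅ ε
  ... | ‵inject₁ y = Ext-inject₁ (ExtMany-least m (A ∘ inject₁) y)

  module Last (m : ℕ) (A : Fin (suc m) → Pred E 0ℓ) =
    OnePoint (Ext^ m (A ∘ inject₁)) (EmbPred m (A (fromℕ m)))
             (ExtMany-refl m _) (ExtMany-trans m _) (ExtMany-least m _)

  ExtMany-emb : ∀ m A {x y} → x ≼ y → Ext^ m A (emb m x) (emb m y)
  ExtMany-emb zero    A x≼y = x≼y
  ExtMany-emb (suc m) A x≼y = Ext-inject₁ (ExtMany-emb m (A ∘ inject₁) x≼y)

  ExtMany-reflect : ∀ m A {x y} → Ext^ m A (emb m x) (emb m y) → x ≼ y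
  ExtMany-reflect zero    A p = p
  ExtMany-reflect (suc m) A p = ExtMany-reflect m (A ∘ inject₁) (Last.Ext-reflect m A p)

  EmbPred-≢𝟎 : ∀ m {P} → AvoidsZero _≼_ P → ∀ {b} → EmbPred m P b → b ≢ 𝟎
  EmbPred-≢𝟎 m P∌𝟎 (x , Px , refl) = emb-≢𝟎 m (P∌𝟎 x Px)

  ExtMany-≼𝟎 : ∀ m A → (∀ i → AvoidsZero _≼_ (A i)) → ∀ {u} → Ext^ m A u 𝟎 → u ≡ 𝟎
  ExtMany-≼𝟎 zero    A _   {u} u≼𝟎 = antisym u≼𝟎 (≼-least u)
  ExtMany-≼𝟎 (suc m) A A∌𝟎 {u} u≼𝟎 with view u
  ... | ‵inject₁ y =
    cong inject₁ (ExtMany-≼𝟎 m _ (A∌𝟎 ∘ inject₁) (Last.Ext-reflect m A {y = 𝟎} u≼𝟎))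
  ... | ‵fromℕ with Last.Ext-new-old m A {y = 𝟎} u≼𝟎
  ...   | b , Bb , b≼𝟎 =
    ⊥-elim (EmbPred-≢𝟎 m (A∌𝟎 (fromℕ m)) Bb (ExtMany-≼𝟎 m _ (A∌𝟎 ∘ inject₁) b≼𝟎))

  below-new : ∀ m A → (∀ i → AvoidsZero _≼_ (A i)) →
              ∀ {w z} → IsNew z → Ext^ m A w z → w ≡ z ⊎ w ≡ 𝟎
  below-new zero    A _   {z = z} z-new _ = ⊥-elim (¬IsNew-old z z-new)
  below-new (suc m) A A∌𝟎 {w} {z} z-new w≼z with view z | view w
  ... | ‵fromℕ     | ‵fromℕ     = inj₁ refl
  ... | ‵fromℕ     | ‵inject₁ u =
    inj₂ (cong inject₁ (ExtMany-≼𝟎 m _ (A∌𝟎 ∘ inject₁) (Last.Ext-old-new m A w≼z)))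
  ... | ‵inject₁ y | ‵inject₁ u =
    Sum.map (cong inject₁) (cong inject₁)
      (below-new m _ (A∌𝟎 ∘ inject₁) (IsNew-inject₁⁻¹ z-new) (Last.Ext-reflect m A w≼z))
  ... | ‵inject₁ y | ‵fromℕ with Last.Ext-new-old m A w≼z
  ...   | b , (x , Ax , refl) , b≼y with below-new m _ (A∌𝟎 ∘ inject₁) (IsNew-inject₁⁻¹ z-new) b≼y
  ...     | inj₁ refl = ⊥-elim (¬IsNew-emb m x (IsNew-inject₁⁻¹ z-new))
  ...     | inj₂ b≡𝟎  = ⊥-elim (emb-≢𝟎 m (A∌𝟎 (fromℕ m) x Ax) b≡𝟎)

  new-incomparable : ∀ m A → (∀ i → AvoidsZero _≼_ (A i)) →
                     ∀ {w z} → IsNew w → IsNew z → Ext^ m A w z → w ≡ z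
  new-incomparable m A A∌𝟎 w-new z-new w≼z with below-new m A A∌𝟎 z-new w≼z
  ... | inj₁ w≡z  = w≡z
  ... | inj₂ refl with () ← w-new

  another-new-point : ∀ m (c : Fin (suc (suc (suc (suc (m + n)))))) → ∃ λ e → IsNew e × e ≢ c
  another-new-point m c with view c
  ... | ‵fromℕ     = inject₁ (fromℕ _) , IsNew-inject₁ (IsNew-fromℕ m) , fromℕ≢inject₁ ∘ sym
  ... | ‵inject₁ y = fromℕ _ , IsNew-fromℕ (suc m) , fromℕ≢inject₁

  ¬comparable-new : ∀ m A → (∀ i → AvoidsZero _≼_ (A i)) →
                    ∀ {c} → IsNew c → ¬ ComparableToAll (Ext^ (suc (suc m)) A) c
  ¬comparable-new m A A∌𝟎 {c} c-new comparable with another-new-point m c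
  ... | e , e-new , e≢c with comparable e
  ...   | inj₁ c≼e = e≢c (sym (new-incomparable _ A A∌𝟎 c-new e-new c≼e))
  ...   | inj₂ e≼c = e≢c (new-incomparable _ A A∌𝟎 e-new c-new e≼c)

  emb-comparableToAll : ∀ m A {c} → (∀ i → ∃ λ a → A i a × a ≼ c) →
                        ComparableToAll _≼_ c → ComparableToAll (Ext^ m A) (emb m c)
  emb-comparableToAll zero    A _     comparable = comparable
  emb-comparableToAll (suc m) A below comparable z with view z
  ... | ‵inject₁ y = Sum.map Ext-inject₁ Ext-inject₁
                       (emb-comparableToAll m (A ∘ inject₁) (below ∘ inject₁) comparable y)
  ... | ‵fromℕ with below (fromℕ m)
  ...   | a , Aa , a≼c = inj₂ (na (a , Aa , refl) ◅ Ext-inject₁ (ExtMany-emb m _ a≼c))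

  emb-comparableToAll⁻¹ : ∀ m A {c} → ComparableToAll (Ext^ m A) (emb m c) → ComparableToAll _≼_ c
  emb-comparableToAll⁻¹ m A comparable y =
    Sum.map (ExtMany-reflect m A) (ExtMany-reflect m A) (comparable (emb m y))

  vertDecomp-ExtMany : ∀ m A {c} → c ≢ 𝟎 → c ≢ 𝟏 → ComparableToAll _≼_ c →
                       (∀ i → ∃ λ a → A i a × a ≼ c) → VertDecomp (Ext^ m A)
  vertDecomp-ExtMany m A c≢𝟎 c≢𝟏 comparable below =
    emb m _ , emb-≢𝟎 m c≢𝟎 , emb-≢𝟏 m c≢𝟏 , emb-comparableToAll m A below comparable

  top-comparable⇔Up-covers : ∀ A → ComparableToAll (Ext^ 1 A) (fromℕ (suc (suc n))) ⇔
                                   (∀ x → x ≢ 𝟎 → Up _≼_ (A zero) x)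
  top-comparable⇔Up-covers A = mk⇔ covers comparable
    where
    covers : ComparableToAll (Ext^ 1 A) (fromℕ (suc (suc n))) → ∀ x → x ≢ 𝟎 → Up _≼_ (A zero) x
    covers top-comparable x x≢𝟎 with top-comparable (inject₁ x)
    ... | inj₁ top≼x with Last.Ext-new-old 0 A top≼x
    ...   | _ , (a , Aa , refl) , a≼x = a , Aa , a≼x
    covers top-comparable x x≢𝟎 | inj₂ x≼top =
      ⊥-elim (x≢𝟎 (antisym (Last.Ext-old-new 0 A x≼top) (≼-least x)))

    comparable : (∀ x → x ≢ 𝟎 → Up _≼_ (A zero) x) → ComparableToAll (Ext^ 1 A) (fromℕ (suc (suc n)))
    comparable up z with view z
    ... | ‵fromℕ     = inj₁ ε
    ... | ‵inject₁ y with y ≟ 𝟎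
    ...   | yes refl = inj₂ (zn ◅ ε)
    ...   | no y≢𝟎 with up y y≢𝟎
    ...     | a , Aa , a≼y = inj₁ (na (a , Aa , refl) ◅ Ext-inject₁ a≼y)

  vertDecomp-emb⁻¹ : ∀ m A {x} → emb m x ≢ 𝟎 → emb m x ≢ 𝟏 →
                     ComparableToAll (Ext^ m A) (emb m x) → VertDecomp _≼_
  vertDecomp-emb⁻¹ m A {x} x≢𝟎 x≢𝟏 comparable =
    x , (λ x≡𝟎 → x≢𝟎 (trans (cong (emb m) x≡𝟎) (emb-𝟎 m)))
      , (λ x≡𝟏 → x≢𝟏 (trans (cong (emb m) x≡𝟏) (emb-𝟏 m)))
      , emb-comparableToAll⁻¹ m A comparable

  comparable-new⇒single : ∀ m′ A → (∀ i → AvoidsZero _≼_ (A i)) →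
                          ∀ {c} → IsNew c → ComparableToAll (Ext^ (suc m′) A) c →
                          suc m′ ≡ 1 × (∀ x → x ≢ 𝟎 → Up _≼_ (A zero) x)
  comparable-new⇒single (suc m″) A A∌𝟎 c-new comparable =
    ⊥-elim (¬comparable-new m″ A A∌𝟎 c-new comparable)
  comparable-new⇒single zero A _ {c} c-new comparable with view c
  ... | ‵inject₁ y = ⊥-elim (¬IsNew-old y (IsNew-inject₁⁻¹ c-new))
  ... | ‵fromℕ     = refl , Equivalence.to (top-comparable⇔Up-covers A) comparable

  vertDecomp-ExtMany⇒ : ¬ VertDecomp _≼_ → ∀ m′ A → (∀ i → AvoidsZero _≼_ (A i)) →
                        VertDecomp (Ext^ (suc m′) A) →
                        suc m′ ≡ 1 × (∀ x → x ≢ 𝟎 → Up _≼_ (A zero) x)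
  vertDecomp-ExtMany⇒ indecomposable m′ A A∌𝟎 (c , c≢𝟎 , c≢𝟏 , comparable) with IsNew? c
  ... | yes c-new = comparable-new⇒single m′ A A∌𝟎 c-new comparable
  ... | no c-old with ¬IsNew⇒emb (suc m′) c c-old
  ...   | _ , refl = ⊥-elim (indecomposable (vertDecomp-emb⁻¹ (suc m′) A c≢𝟎 c≢𝟏 comparable))

module Depth {n : ℕ} {_≼_ : Rel (Fin (suc (suc n))) 0ℓ}
             (isDecPartialOrder : IsDecPartialOrder _≡_ _≼_) where

  open IsDecPartialOrder isDecPartialOrder using (antisym; _≤?_) renaming (refl to ≼-refl; trans to ≼-trans)

  private
    E = Fin (suc (suc n))

  _≺?_ : Decidable (_≺_ _≼_)
  x ≺? y = (x ≤? y) ×-dec ¬? (x ≟ y)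

  Chain? : ∀ q a b → Dec (Chain _≼_ a b q)
  Chain? zero a b with a ≟ b
  ... | yes refl = yes single
  ... | no a≢b   = no λ { single → a≢b refl }
  Chain? (suc q) a b with any? (λ c → (a ≺? c) ×-dec Chain? q c b)
  ... | yes (c , a≺c , ch) = yes (step a≺c ch)
  ... | no ∄c              = no λ { (step a≺c ch) → ∄c (_ , a≺c , ch) }

  elements : ∀ {a b p} → Chain _≼_ a b p → Fin (suc p) → E
  elements {a} _  zero        = a
  elements (step _ ch) (suc i) = elements ch i

  head≼elements : ∀ {a b p} (ch : Chain _≼_ a b p) i → a ≼ elements ch i
  head≼elements _              zero    = ≼-refl
  head≼elements (step a≺c ch) (suc i) = ≼-trans (proj₁ a≺c) (head≼elements ch i)

  elements-distinct : ∀ {a b p} (ch : Chain _≼_ a b p) {i j} → i < j → elements ch i ≢ elements ch j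
  elements-distinct (step a≺c ch) {zero}  {suc j} _         a≡ =
    proj₂ a≺c (antisym (proj₁ a≺c) (subst (_ ≼_) (sym a≡) (head≼elements ch j)))
  elements-distinct (step _   ch) {suc i} {suc j} (s≤s i<j) = elements-distinct ch i<j

  chain-length< : ∀ {a b p} → Chain _≼_ a b p → p ℕ.< suc (suc n)
  chain-length< {p = p} ch with suc p ℕ.≤? suc (suc n)
  ... | yes p< = p<
  ... | no p≮ with pigeonhole (ℕₚ.≰⇒> p≮) (elements ch)
  ...   | i , j , i<j , same = ⊥-elim (elements-distinct ch i<j same)

  dep-exists : ∀ {a q} → Chain _≼_ a 𝟏 q → ∃ (Dep _≼_ a)
  dep-exists ch = bounded-maximum (λ q → Chain? q _ 𝟏) _ chain-length< (_ , ch)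

  deepest-level-minimal : Levellised _≼_ → ∀ {k} → Dep _≼_ (fromℕ (suc n)) k →
                          ∀ {a c} → Lev _≼_ k a → c ≢ 𝟎 → c ≼ a → c ≡ a
  deepest-level-minimal levellised dep-top {a = a} {c} a∈lev c≢𝟎 c≼a =
    decidable-stable (c ≟ a) λ c≢a →
      let longer      = step (c≼a , c≢a) (proj₁ a∈lev)
          (p , dep-c) = dep-exists longer
          p≤k         = levellised c (fromℕ (suc n)) (ℕₚ.n≢0⇒n>0 (c≢𝟎 ∘ toℕ-injective)) (≤fromℕ c)
                                   p _ dep-c dep-top
      in ℕₚ.1+n≰n (ℕₚ.≤-trans (proj₂ dep-c _ longer) p≤k)

module NLattice {n : ℕ} {_≼_ : Rel (Fin (suc (suc n))) 0ℓ} {_∨_ _∧_ : Op₂ (Fin (suc (suc n)))}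
                (L : IsNLattice _≼_ _∨_ _∧_) where

  open IsNLattice L

  ≼-isDecPartialOrder : IsDecPartialOrder _≡_ _≼_
  ≼-isDecPartialOrder = ≈-dec⇒isDecPartialOrder meetSemilattice _≟_
    where
    meetSemilattice : MeetSemilattice 0ℓ 0ℓ 0ℓ
    meetSemilattice = record { isMeetSemilattice = IsLattice.isMeetSemilattice isLattice }

  open IsDecPartialOrder ≼-isDecPartialOrder using (isPartialOrder; antisym; reflexive)
  open Iterated isPartialOrder zero-least public
  open Depth ≼-isDecPartialOrder public

  Up-avoidsZero : ∀ {P} → AvoidsZero _≼_ P → AvoidsZero _≼_ (Up _≼_ P)
  Up-avoidsZero P∌𝟎 x (a , Pa , a≼x) refl = P∌𝟎 a Pa (antisym a≼x (zero-least a))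

  deepest-level-below : Levellised _≼_ → ∀ {k} → Dep _≼_ (fromℕ (suc n)) k →
                        ∀ {c} → c ≢ 𝟎 → ComparableToAll _≼_ c → ∀ {a} → Lev _≼_ k a → a ≼ c
  deepest-level-below levellised dep-top c≢𝟎 comparable {a} a∈lev with comparable a
  ... | inj₁ c≼a = reflexive (sym (deepest-level-minimal levellised dep-top a∈lev c≢𝟎 c≼a))
  ... | inj₂ a≼c = a≼c

lemma4p3 : (n : ℕ) (_≼_ : Rel (Fin (suc (suc n))) 0ℓ) (_∨_ _∧_ : Op₂ (Fin (suc (suc n)))) →
    IsNLattice _≼_ _∨_ _∧_ → Levellised _≼_ →
    (k : ℕ) → Dep _≼_ (fromℕ (suc n)) k →
    (m′ : ℕ) (A : Fin (suc m′) → Pred (Fin (suc (suc n))) 0ℓ) →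
    (∀ i → AvoidsZero _≼_ (A i)) →
    (∀ i → ∃ λ a → A i a × Lev _≼_ k a) →
    (∀ i → IsLatticeAntichain _≼_ _∧_ (A i)) →
    (∀ i j → i < j → ∀ a b → Up _≼_ (A i) a → Up _≼_ (A j) a →
       Up _≼_ (A i) b → Up _≼_ (A j) b → (a ∧ b) ≢ zero) →
    (VertDecomp _≼_ → VertDecomp (ExtMany (suc m′) _≼_ A)) ×
    (¬ VertDecomp _≼_ →
       (VertDecomp (ExtMany (suc m′) _≼_ A) ⇔
         (suc m′ ≡ 1 × (∀ x → x ≢ zero → Up _≼_ (A zero) x) × (∀ x → Up _≼_ (A zero) x → x ≢ zero))))
lemma4p3 n _≼_ _∨_ _∧_ L levellised k dep-top m′ A A∌𝟎 levelled _ _ =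
  decomposable , λ indecomposable → mk⇔ (forward indecomposable) backward
  where
  open NLattice L

  decomposable : VertDecomp _≼_ → VertDecomp (ExtMany (suc m′) _≼_ A)
  decomposable (c , c≢𝟎 , c≢𝟏 , comparable) =
    vertDecomp-ExtMany (suc m′) A c≢𝟎 c≢𝟏 comparable λ i →
      let (a , Aa , a∈lev) = levelled i
      in a , Aa , deepest-level-below levellised dep-top c≢𝟎 comparable a∈lev

  Criterion : Set
  Criterion = suc m′ ≡ 1 × (∀ x → x ≢ zero → Up _≼_ (A zero) x) × (∀ x → Up _≼_ (A zero) x → x ≢ zero)

  forward : ¬ VertDecomp _≼_ → VertDecomp (ExtMany (suc m′) _≼_ A) → Criterion
  forward indecomposable decomp =
    let (m≡1 , covers) = vertDecomp-ExtMany⇒ indecomposable m′ A A∌𝟎 decomp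
    in m≡1 , covers , Up-avoidsZero (A∌𝟎 zero)

  backward : Criterion → VertDecomp (ExtMany (suc m′) _≼_ A)
  backward (refl , covers , _) =
    fromℕ (suc (suc n)) , (λ ()) , (λ ()) , Equivalence.from (top-comparable⇔Up-covers A) covers
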